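{- Let $A$ be a pseudo-BCI algebra and let $d$ be a type I implicative derivation on $A$ such that $d(x)\in \mathrm{At}(A)$ for all $x\in A$. Then $d(x\to y)=x\to d(y)$ and $d(x\rightsquigarrow y)=x\rightsquigarrow d(y)$ for all $x,y\in A$.
   Context: A pseudo-BCI algebra is a structure $(A,\to,\rightsquigarrow,1)$ of type $(2,2,0)$ such that for all $x,y,z\in A$: $(x\to y)\rightsquigarrow[(y\to z)\rightsquigarrow(x\to z)]=1$; $(x\rightsquigarrow y)\to[(y\rightsquigarrow z)\to(x\rightsquigarrow z)]=1$; $1\to x=x$; $1\rightsquigarrow x=x$; and $x\to y=1$, $y\to x=1$ imply $x=y$. Write $x\le y$ iff $x\to y=1$. $\mathrm{At}(A)$ is the set of atoms, i.e. elements $a$ such that $a\le x$ implies $x=a$. Put $x\Cup_1 y=(x\to y)\rightsquigarrow y$ and $x\Cup_2 y=(x\rightsquigarrow y)\to y$. A map $d:A\to A$ is a type I implicative derivation if $d(x\to y)=(x\to d(y))\Cup_2(d(x)\to y)$ and $d(x\rightsquigarrow y)=(x\rightsquigarrow d(y))\Cup_1(d(x)\rightsquigarrow y)$ for all $x,y\in A$. -}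

module Defs where

open import Level using (Level; suc)
open import Relation.Binary.PropositionalEquality using (_≡_)
open import Data.Product using (_×_)

record PseudoBCI (ℓ : Level) : Set (suc ℓ) where
  infixr 5 _⇒_ _⇝_
  field
    Carrier : Set ℓ
    _⇒_     : Carrier → Carrier → Carrier
    _⇝_     : Carrier → Carrier → Carrier
    𝟏       : Carrier
    ax1 : ∀ x y z → (x ⇒ y) ⇝ ((y ⇒ z) ⇝ (x ⇒ z)) ≡ 𝟏
    ax2 : ∀ x y z → (x ⇝ y) ⇒ ((y ⇝ z) ⇒ (x ⇝ z)) ≡ 𝟏
    ax3 : ∀ x → 𝟏 ⇒ x ≡ x
    ax4 : ∀ x → 𝟏 ⇝ x ≡ x
    ax5 : ∀ x y → x ⇒ y ≡ 𝟏 → y ⇒ x ≡ 𝟏 → x ≡ y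

  _≤_ : Carrier → Carrier → Set ℓ
  x ≤ y = x ⇒ y ≡ 𝟏

  IsAtom : Carrier → Set ℓ
  IsAtom a = ∀ x → a ≤ x → x ≡ a

  _⋓₁_ : Carrier → Carrier → Carrier
  x ⋓₁ y = (x ⇒ y) ⇝ y

  _⋓₂_ : Carrier → Carrier → Carrier
  x ⋓₂ y = (x ⇝ y) ⇒ y

  IsTypeIImplicativeDerivation : (Carrier → Carrier) → Set ℓ
  IsTypeIImplicativeDerivation d =
    (∀ x y → d (x ⇒ y) ≡ (x ⇒ d y) ⋓₂ (d x ⇒ y)) ×
    (∀ x y → d (x ⇝ y) ≡ (x ⇝ d y) ⋓₁ (d x ⇝ y))

module Submission where

open import Defs
open import Level using (Level)
open import Data.Product using (_×_; _,_)
open import Relation.Binary.PropositionalEquality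
  using (_≡_; refl; sym; trans; cong; subst; subst₂; module ≡-Reasoning)

-- Atoms are closed under x → _ and x ⇝ _, by the exchange law x → (y ⇝ z) = y ⇝ (x → z).
-- Since x → d(y) ≤ (x → d(y)) ⋓₂ (d(x) → y) = d(x → y), the atom x → d(y) lies below
-- d(x → y) and therefore equals it.  The ⇝-half is the →-half in the
-- opposite algebra, in which → and ⇝ trade places.

module Properties {ℓ : Level} (A : PseudoBCI ℓ) where
  open PseudoBCI A
  open ≡-Reasoning

  _≼_ : Carrier → Carrier → Set ℓ
  x ≼ y = x ⇝ y ≡ 𝟏

  ⇒-mp : ∀ {p q} → p ≡ 𝟏 → p ⇒ q ≡ 𝟏 → q ≡ 𝟏
  ⇒-mp refl h = trans (sym (ax3 _)) h

  ⇝-mp : ∀ {p q} → p ≡ 𝟏 → p ⇝ q ≡ 𝟏 → q ≡ 𝟏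
  ⇝-mp refl h = trans (sym (ax4 _)) h

  ⇒-refl : ∀ x → x ⇒ x ≡ 𝟏
  ⇒-refl x = subst (λ t → t ⇒ t ≡ 𝟏) (ax4 x) (⇒-mp (ax4 𝟏) (ax2 𝟏 𝟏 x))

  ⇝-refl : ∀ x → x ⇝ x ≡ 𝟏
  ⇝-refl x = subst (λ t → t ⇝ t ≡ 𝟏) (ax3 x) (⇝-mp (ax3 𝟏) (ax1 𝟏 𝟏 x))

  ≤-⋓₂ : ∀ x y → x ≤ (x ⋓₂ y)
  ≤-⋓₂ x y = subst₂ (λ s t → s ⇒ ((x ⇝ y) ⇒ t) ≡ 𝟏) (ax4 x) (ax4 y) (ax2 𝟏 x y)

  ≼-⋓₁ : ∀ x y → x ≼ (x ⋓₁ y)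
  ≼-⋓₁ x y = subst₂ (λ s t → s ⇝ ((x ⇒ y) ⇝ t) ≡ 𝟏) (ax3 x) (ax3 y) (ax1 𝟏 x y)

  ≼⇒≤ : ∀ {x y} → x ≼ y → x ≤ y
  ≼⇒≤ {x} {y} h = subst (λ t → x ⇒ t ≡ 𝟏) (trans (cong (_⇒ y) h) (ax3 y)) (≤-⋓₂ x y)

  ≤⇒≼ : ∀ {x y} → x ≤ y → x ≼ y
  ≤⇒≼ {x} {y} h = subst (λ t → x ⇝ t ≡ 𝟏) (trans (cong (_⇝ y) h) (ax4 y)) (≼-⋓₁ x y)

  ≤-⋓₁ : ∀ x y → x ≤ (x ⋓₁ y)
  ≤-⋓₁ x y = ≼⇒≤ (≼-⋓₁ x y)

  ⇒-antitoneˡ : ∀ {x y} z → x ≤ y → (y ⇒ z) ≤ (x ⇒ z)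
  ⇒-antitoneˡ {x} {y} z h = ≼⇒≤ (⇝-mp h (ax1 x y z))

  ⇝-antitoneˡ : ∀ {x y} z → x ≤ y → (y ⇝ z) ≤ (x ⇝ z)
  ⇝-antitoneˡ {x} {y} z h = ⇒-mp (≤⇒≼ h) (ax2 x y z)

  ⇒-monotoneʳ : ∀ x {y z} → y ≤ z → (x ⇒ y) ≤ (x ⇒ z)
  ⇒-monotoneʳ x {y} {z} h =
    ≼⇒≤ (subst (λ t → (x ⇒ y) ⇝ t ≡ 𝟏) (trans (cong (_⇝ (x ⇒ z)) h) (ax4 _)) (ax1 x y z))

  ≤-trans : ∀ {x y z} → x ≤ y → y ≤ z → x ≤ z
  ≤-trans {z = z} x≤y y≤z = ⇒-mp y≤z (⇒-antitoneˡ z x≤y)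

  ≤-⇒-swap : ∀ {x y w} → x ≤ (y ⇝ w) → y ≤ (x ⇒ w)
  ≤-⇒-swap {y = y} {w} h = ≤-trans (≤-⋓₂ y w) (⇒-antitoneˡ w h)

  ≤-⇝-swap : ∀ {x y w} → x ≤ (y ⇒ w) → y ≤ (x ⇝ w)
  ≤-⇝-swap {y = y} {w} h = ≤-trans (≤-⋓₁ y w) (⇝-antitoneˡ w h)

  ⇒-compose : ∀ x y z → (y ⇒ z) ≤ ((x ⇒ y) ⇒ (x ⇒ z))
  ⇒-compose x y z = ≤-⇒-swap (≼⇒≤ (ax1 x y z))

  ⇝-compose : ∀ x y z → (y ⇝ z) ≤ ((x ⇝ y) ⇝ (x ⇝ z))
  ⇝-compose x y z = ≤-⇝-swap (ax2 x y z)

  exchange : ∀ x y z → x ⇒ (y ⇝ z) ≡ y ⇝ (x ⇒ z)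
  exchange x y z = ax5 _ _
    (≤-⇝-swap (≤-trans (≤-⋓₂ y z) (⇒-compose x (y ⇝ z) z)))
    (≤-⇒-swap (≤-trans (≤-⋓₁ x z) (⇝-compose y (x ⇒ z) z)))

  ⇒𝟏≡⇝𝟏 : ∀ x → x ⇒ 𝟏 ≡ x ⇝ 𝟏
  ⇒𝟏≡⇝𝟏 x = begin
    x ⇒ 𝟏        ≡⟨ cong (x ⇒_) (sym (⇝-refl x)) ⟩
    x ⇒ (x ⇝ x)  ≡⟨ exchange x x x ⟩
    x ⇝ (x ⇒ x)  ≡⟨ cong (x ⇝_) (⇒-refl x) ⟩
    x ⇝ 𝟏        ∎

  ⇝-⇒-self : ∀ x y → y ⇝ (x ⇒ y) ≡ x ⇒ 𝟏
  ⇝-⇒-self x y = begin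
    y ⇝ (x ⇒ y)  ≡⟨ sym (exchange x y y) ⟩
    x ⇒ (y ⇝ y)  ≡⟨ cong (x ⇒_) (⇝-refl y) ⟩
    x ⇒ 𝟏        ∎

  ≤-⇒𝟏⇒𝟏 : ∀ x → x ≤ ((x ⇒ 𝟏) ⇒ 𝟏)
  ≤-⇒𝟏⇒𝟏 x = subst (λ t → x ≤ (t ⇒ 𝟏)) (sym (⇒𝟏≡⇝𝟏 x)) (≤-⋓₂ x 𝟏)

  -- With u = x → 𝟏: from a ⇝ (x → a) = u we get a ≤ u → (x → a) ≤ u → z, so u → z = a by
  -- atomicity, whence z ⇝ a = u → 𝟏 lies above x, i.e. z ≤ x → a.
  ⇒-preserves-atom : ∀ x {a} → IsAtom a → IsAtom (x ⇒ a)
  ⇒-preserves-atom x {a} atom z x⇒a≤z = ax5 _ _ z≤x⇒a x⇒a≤z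
    where
    u = x ⇒ 𝟏

    a≤u⇒z : a ≤ (u ⇒ z)
    a≤u⇒z = ≤-trans
      (≤-⇒-swap (subst (u ≤_) (sym (⇝-⇒-self x a)) (⇒-refl u)))
      (⇒-monotoneʳ u x⇒a≤z)

    z⇝a≡u⇒𝟏 : z ⇝ a ≡ u ⇒ 𝟏
    z⇝a≡u⇒𝟏 = trans (cong (z ⇝_) (sym (atom _ a≤u⇒z))) (⇝-⇒-self u z)

    z≤x⇒a : z ≤ (x ⇒ a)
    z≤x⇒a = ≤-⇒-swap (subst (x ≤_) (sym z⇝a≡u⇒𝟏) (≤-⇒𝟏⇒𝟏 x))

  derivation-⇒ : (d : Carrier → Carrier) →
    (∀ x y → d (x ⇒ y) ≡ (x ⇒ d y) ⋓₂ (d x ⇒ y)) →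
    (∀ x → IsAtom (d x)) →
    ∀ x y → d (x ⇒ y) ≡ x ⇒ d y
  derivation-⇒ d rule atom x y =
    ⇒-preserves-atom x (atom y) _ (subst ((x ⇒ d y) ≤_) (sym (rule x y)) (≤-⋓₂ _ _))

opposite : {ℓ : Level} → PseudoBCI ℓ → PseudoBCI ℓ
opposite A = record
  { Carrier = Carrier
  ; _⇒_ = _⇝_
  ; _⇝_ = _⇒_
  ; 𝟏 = 𝟏
  ; ax1 = ax2
  ; ax2 = ax1
  ; ax3 = ax4
  ; ax4 = ax3
  ; ax5 = λ x y x≼y y≼x → ax5 x y (≼⇒≤ x≼y) (≼⇒≤ y≼x)
  }
  where open PseudoBCI A
        open Properties A

atom-opposite : {ℓ : Level} (A : PseudoBCI ℓ) {a : PseudoBCI.Carrier A} →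
  PseudoBCI.IsAtom A a → PseudoBCI.IsAtom (opposite A) a
atom-opposite A atom x a≼x = atom x (Properties.≼⇒≤ A a≼x)

proposition3p24 : {ℓ : Level} (A : PseudoBCI ℓ) → let open PseudoBCI A in
    (d : Carrier → Carrier) → IsTypeIImplicativeDerivation d →
    (∀ x → IsAtom (d x)) →
    (∀ x y → d (x ⇒ y) ≡ x ⇒ d y) × (∀ x y → d (x ⇝ y) ≡ x ⇝ d y)
proposition3p24 A d (rule⇒ , rule⇝) atom =
  Properties.derivation-⇒ A d rule⇒ atom ,
  Properties.derivation-⇒ (opposite A) d rule⇝ (λ x → atom-opposite A (atom x))
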